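{- Let $X, Y$ be 1-morphisms in $\mathrm{Free}(\mathcal E)$ in left-pseudomonoid form, such that there exists a rotational 2-morphism $X\Rightarrow Y$. Then $X$ and $Y$ are identical as composites.
   Context: $\mathcal E$ is the extended Frobenius presentation: object $C$; 1-morphisms $m: C\boxtimes C\to C$, $u:1\to C$, $\cup:1\to C\boxtimes C$, $f:C\to 1$, $\cap:C\boxtimes C\to 1$; pseudomonoid 2-morphisms $\alpha,\lambda,\rho$; invertible $\mu,\nu$ (snake composites of $\cup$ with $f\circ m$ to $1_C$) and $\pi:\cap\Rightarrow f\circ m$; snakeorators $\sigma_1,\sigma_2$ (from the two snake composites of $\cup,\cap$ to $1_C$) and inverses; rotation generators $R_m, L_m, R_u, L_u, R_f, L_f$ rotating $m$, $u$, $f$ one step clockwise or anticlockwise using cups and caps, each defined as a composite of other generators. $\mathrm{Free}(\mathcal E)$ is its free monoidal bicategory, with 1-morphisms generic composites (each generator at its own height, diagrams read bottom to top). A 2-morphism is rotational if it is a composite of $R_m,L_m,R_u,L_u,R_f,L_f,\sigma_1^{\pm1},\sigma_2^{\pm1}$ and interchangers. A 1-morphism is in left-pseudomonoid form if it is identical to $u$, or identical to $m\circ(U\boxtimes 1_C)\circ(1_C^{\boxtimes k}\boxtimes V)$ with $U,V$ in left-pseudomonoid form and $k$ the number of inputs of $U$ (so the subdiagram on the left input of the topmost $m$ lies entirely above that on the right input). -}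

module Defs where

open import Data.Nat using (ℕ; zero; suc; _+_; _∸_; _≤_)
open import Data.Product using (_×_; _,_)
open import Data.List using (List; []; _∷_; _++_; map)
open import Relation.Binary.PropositionalEquality using (_≡_)
open import Relation.Binary.Construct.Closure.ReflexiveTransitive using (Star)

-- Generating 1-morphisms of the extended Frobenius presentation E.
-- Every 1-morphism has source/target a tensor power C^{⊠n}; we record n.

data Gen : Set where
  m u cup f cap : Gen

ins : Gen → ℕ
ins m   = 2
ins u   = 0
ins cup = 0
ins f   = 1
ins cap = 2

outs : Gen → ℕ
outs m   = 1
outs u   = 1
outs cup = 2
outs f   = 0
outs cap = 0

-- 1-morphisms of Free(E) as generic composites: a list of heights, read
-- bottom to top; at each height exactly one generator, placed with
-- `l` identity wires to its left (any number of identity wires to its right).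

Layer : Set
Layer = ℕ × Gen

Diagram : Set
Diagram = List Layer

-- Typed a X b : the generic composite X is a 1-morphism C^{⊠a} → C^{⊠b}.
data Typed : ℕ → Diagram → ℕ → Set where
  done : ∀ {n} → Typed n [] n
  next : ∀ {n b l g ls} (r : ℕ) → n ≡ l + ins g + r →
         Typed (l + outs g + r) ls b → Typed n ((l , g) ∷ ls) b

shiftBy : ℕ → Layer → Layer
shiftBy k (l , g) = (k + l , g)

whiskerL : ℕ → Diagram → Diagram
whiskerL k = map (shiftBy k)

-- Left-pseudomonoid form:  u,  or  m ∘ (U ⊠ 1_C) ∘ (1_C^{⊠k} ⊠ V)
-- with k the number of inputs of U.  (Tensoring with identities on the
-- right does not change offsets.)

data LPForm : ℕ → Diagram → Set where
  lp-u : LPForm 0 ((0 , u) ∷ [])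
  lp-m : ∀ {k j U V} → LPForm k U → LPForm j V →
         LPForm (k + j) (whiskerL k V ++ U ++ (0 , m) ∷ [])

-- Rotational generating 2-cells  Cell a b A B : A ⇒ B, with A, B : C^{⊠a} → C^{⊠b}.

data Cell : ℕ → ℕ → Diagram → Diagram → Set where
  σ₁    : Cell 1 1 ((1 , cup) ∷ (0 , cap) ∷ []) []
  σ₁⁻¹  : Cell 1 1 [] ((1 , cup) ∷ (0 , cap) ∷ [])
  σ₂    : Cell 1 1 ((0 , cup) ∷ (1 , cap) ∷ []) []
  σ₂⁻¹  : Cell 1 1 [] ((0 , cup) ∷ (1 , cap) ∷ [])
  -- rotations of m by one step (cyclically permuting its three legs)
  R-m   : Cell 2 1 ((0 , m) ∷ []) ((0 , cup) ∷ (1 , m) ∷ (1 , cap) ∷ [])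
  L-m   : Cell 2 1 ((0 , m) ∷ []) ((2 , cup) ∷ (1 , m) ∷ (0 , cap) ∷ [])
  -- rotations of the one-legged u, f by one step (a full turn)
  R-u   : Cell 0 1 ((0 , u) ∷ []) ((0 , u) ∷ (0 , cup) ∷ (1 , cap) ∷ [])
  L-u   : Cell 0 1 ((0 , u) ∷ []) ((0 , u) ∷ (1 , cup) ∷ (0 , cap) ∷ [])
  R-f   : Cell 1 0 ((0 , f) ∷ []) ((0 , cup) ∷ (0 , f) ∷ (0 , cap) ∷ [])
  L-f   : Cell 1 0 ((0 , f) ∷ []) ((1 , cup) ∷ (2 , f) ∷ (0 , cap) ∷ [])

data Step (n : ℕ) : Diagram → Diagram → Set where
  cell : ∀ {a b A B P Q} (s r : ℕ) → Cell a b A B → Typed n P (s + a + r) →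
         Step n (P ++ whiskerL s A ++ Q) (P ++ whiskerL s B ++ Q)
  -- lower generator g₁ entirely to the left of the upper generator g₂
  interchange₁ : ∀ {P Q l₁ g₁ l₂ g₂} → l₁ + outs g₁ ≤ l₂ →
         Step n (P ++ (l₁ , g₁) ∷ (l₂ , g₂) ∷ Q)
                (P ++ (l₂ ∸ outs g₁ + ins g₁ , g₂) ∷ (l₁ , g₁) ∷ Q)
  -- upper generator g₂ entirely to the left of the lower generator g₁
  interchange₂ : ∀ {P Q l₁ g₁ l₂ g₂} → l₂ + ins g₂ ≤ l₁ →
         Step n (P ++ (l₁ , g₁) ∷ (l₂ , g₂) ∷ Q)
                (P ++ (l₂ , g₂) ∷ (l₁ ∸ ins g₂ + outs g₂ , g₁) ∷ Q)

Rotational : ℕ → Diagram → Diagram → Set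
Rotational n = Star (Step n)

module Submission where

-- Each wire is labelled by a pair of planar binary trees: `up` is the tree
-- formed by the diagram below the wire, `down` the one formed by the diagram
-- above it.  A diagram denotes the relation between input and output
-- labellings it admits.  The constraint imposed by m says that the tree seen
-- through each leg is the node of the trees seen through the other two legs,
-- taken in cyclic order, and cups and caps just swap the two components; so the
-- constraints are invariant under rotation, and every rotational 2-cell and
-- interchanger only enlarges the relation.  A left-pseudomonoid form relates the
-- empty input to a single wire whose `up` tree is exactly the binary tree it
-- encodes, and it is determined by that tree.

open import Defs
open import Data.Nat using (ℕ; zero; suc; _+_; _∸_; _≤_; z≤n; s≤s)
open import Data.Nat.Properties
  using (+-comm; +-cancelʳ-≡; +-∸-assoc; m+[n∸m]≡n; m+n≤o⇒m≤o; m+n≤o⇒n≤o; m≤m+n; ≤-trans; ≤-reflexive)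
open import Data.Nat.Solver using (module +-*-Solver)
open import Data.Product using (∃; _×_; _,_; proj₁; swap)
open import Data.List using (List; []; _∷_; _++_; length)
open import Data.List.Properties using (length-++; map-id; map-cong; ∷-injectiveˡ)
open import Data.Empty using (⊥)
open import Level using (0ℓ)
open import Relation.Binary.Core using (Rel)
open import Relation.Binary.Construct.Closure.ReflexiveTransitive using (ε; _◅_)
open import Relation.Binary.PropositionalEquality using (_≡_; refl; sym; trans; cong; subst; module ≡-Reasoning)

open +-*-Solver using (solve; _:+_; _:=_)

WireRel : Set → Set₁
WireRel W = Rel (List W) 0ℓ

infixr 9 _⨾_

_⨾_ : ∀ {W} → WireRel W → WireRel W → WireRel W
(R ⨾ S) xs zs = ∃ λ ys → R xs ys × S ys zs

Whisker : ∀ {W} → ℕ → WireRel W → WireRel W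
Whisker zero    R xs       ys       = R xs ys
Whisker (suc l) R []       _        = ⊥
Whisker (suc l) R (_ ∷ _)  []       = ⊥
Whisker (suc l) R (x ∷ xs) (y ∷ ys) = x ≡ y × Whisker l R xs ys

module _ {W : Set} where

  Whisker-length : ∀ s {R : WireRel W} {xs ys} → Whisker s R xs ys → s ≤ length ys
  Whisker-length zero    _ = z≤n
  Whisker-length (suc s) {xs = _ ∷ _} {_ ∷ _} (_ , w) = s≤s (Whisker-length s w)

  Whisker-refl : ∀ s {xs : List W} → s ≤ length xs → Whisker s _≡_ xs xs
  Whisker-refl zero    _ = refl
  Whisker-refl (suc s) {_ ∷ _} (s≤s le) = refl , Whisker-refl s le

  Whisker-≡ : ∀ s {xs ys : List W} → Whisker s _≡_ xs ys → xs ≡ ys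
  Whisker-≡ zero    e = e
  Whisker-≡ (suc s) {x ∷ _} {_ ∷ _} (refl , w) = cong (x ∷_) (Whisker-≡ s w)

  Whisker-⨾ : ∀ s {R S : WireRel W} {xs ys zs} →
              Whisker s R xs ys → Whisker s S ys zs → Whisker s (R ⨾ S) xs zs
  Whisker-⨾ zero    v w = _ , v , w
  Whisker-⨾ (suc s) {xs = _ ∷ _} {_ ∷ _} {_ ∷ _} (refl , v) (refl , w) = refl , Whisker-⨾ s v w

  Whisker-⨾⁻ : ∀ s {R S : WireRel W} {xs zs} →
               Whisker s (R ⨾ S) xs zs → (Whisker s R ⨾ Whisker s S) xs zs
  Whisker-⨾⁻ zero    w = w
  Whisker-⨾⁻ (suc s) {xs = x ∷ _} {_ ∷ _} (refl , w) with Whisker-⨾⁻ s w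
  ... | ys , v , v′ = x ∷ ys , (refl , v) , (refl , v′)

  Whisker-split : ∀ s l {R : WireRel W} {xs ys} →
                  Whisker (s + l) R xs ys → Whisker s (Whisker l R) xs ys
  Whisker-split zero    l w = w
  Whisker-split (suc s) l {xs = _ ∷ _} {_ ∷ _} (e , w) = e , Whisker-split s l w

  Whisker-merge : ∀ s l {R : WireRel W} {xs ys} →
                  Whisker s (Whisker l R) xs ys → Whisker (s + l) R xs ys
  Whisker-merge zero    l w = w
  Whisker-merge (suc s) l {xs = _ ∷ _} {_ ∷ _} (e , w) = e , Whisker-merge s l w

  Whisker-map : ∀ s a {R S : WireRel W} →
                (∀ {xs ys} → a ≤ length xs → R xs ys → S xs ys) →
                ∀ {xs ys} → s + a ≤ length xs → Whisker s R xs ys → Whisker s S xs ys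
  Whisker-map zero    a h le w = h le w
  Whisker-map (suc s) a h {_ ∷ _} {_ ∷ _} (s≤s le) (e , w) = e , Whisker-map s a h le w

  Whisker-++ : ∀ p t {H : WireRel W} {xs ys} →
               Whisker t H xs ys → Whisker (length p + t) H (p ++ xs) (p ++ ys)
  Whisker-++ []      t w = w
  Whisker-++ (_ ∷ p) t w = refl , Whisker-++ p t w

  Whisker-++ˡ⁻ : ∀ p t {H : WireRel W} {xs ys} → Whisker (length p + t) H (p ++ xs) ys →
                 ∃ λ ys′ → ys ≡ p ++ ys′ × Whisker t H xs ys′
  Whisker-++ˡ⁻ []      t w = _ , refl , w
  Whisker-++ˡ⁻ (_ ∷ p) t {ys = _ ∷ _} (refl , w) with Whisker-++ˡ⁻ p t w
  ... | ys′ , refl , w′ = ys′ , refl , w′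

  Whisker-++ʳ⁻ : ∀ p t {H : WireRel W} {xs ys} → Whisker (length p + t) H xs (p ++ ys) →
                 ∃ λ xs′ → xs ≡ p ++ xs′ × Whisker t H xs′ ys
  Whisker-++ʳ⁻ []      t w = _ , refl , w
  Whisker-++ʳ⁻ (_ ∷ p) t {xs = _ ∷ _} (refl , w) with Whisker-++ʳ⁻ p t w
  ... | xs′ , refl , w′ = xs′ , refl , w′

data Tree : Set where
  leaf : Tree
  node : Tree → Tree → Tree

node-injective : ∀ {s t s′ t′} → node s t ≡ node s′ t′ → s ≡ s′ × t ≡ t′
node-injective refl = refl , refl

Label : Set
Label = Tree × Tree

up down : Label → Tree
up   (t , _) = t
down (_ , t) = t

⟦_⟧ᵍ : Gen → WireRel Label
⟦ u   ⟧ᵍ xs           ys = ∃ λ d → ys ≡ (leaf , d) ∷ xs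
⟦ cup ⟧ᵍ xs           ys = ∃ λ a → ys ≡ a ∷ swap a ∷ xs
⟦ f   ⟧ᵍ []           ys = ⊥
⟦ f   ⟧ᵍ (_ ∷ xs)     ys = ys ≡ xs
⟦ cap ⟧ᵍ (x ∷ y ∷ xs) ys = y ≡ swap x × ys ≡ xs
⟦ cap ⟧ᵍ _            ys = ⊥
⟦ m   ⟧ᵍ (x ∷ y ∷ xs) ys = ∃ λ d → down x ≡ node (up y) d × down y ≡ node d (up x)
                                  × ys ≡ (node (up x) (up y) , d) ∷ xs
⟦ m   ⟧ᵍ _            ys = ⊥

⟦_⟧ : Diagram → WireRel Label
⟦ []          ⟧ = _≡_
⟦ (l , g) ∷ D ⟧ = Whisker l ⟦ g ⟧ᵍ ⨾ ⟦ D ⟧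

⟦++⟧⁻ : ∀ P {Q xs ys} → ⟦ P ++ Q ⟧ xs ys → (⟦ P ⟧ ⨾ ⟦ Q ⟧) xs ys
⟦++⟧⁻ []      {xs = xs} h = xs , refl , h
⟦++⟧⁻ (_ ∷ P) (ws , g , h) with ⟦++⟧⁻ P h
... | zs , hP , hQ = zs , (ws , g , hP) , hQ

⟦++⟧⁺ : ∀ P {Q xs ys} → (⟦ P ⟧ ⨾ ⟦ Q ⟧) xs ys → ⟦ P ++ Q ⟧ xs ys
⟦++⟧⁺ []      (_ , refl , hQ)          = hQ
⟦++⟧⁺ (_ ∷ P) (_ , (ws , g , hP) , hQ) = ws , g , ⟦++⟧⁺ P (_ , hP , hQ)

⟦whiskerL⟧⁻ : ∀ s D {xs ys} → s ≤ length xs → ⟦ whiskerL s D ⟧ xs ys → Whisker s ⟦ D ⟧ xs ys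
⟦whiskerL⟧⁻ s []            le refl = Whisker-refl s le
⟦whiskerL⟧⁻ s ((l , _) ∷ D) le (_ , g , h) =
  Whisker-⨾ s (Whisker-split s l g) (⟦whiskerL⟧⁻ s D (Whisker-length s (Whisker-split s l g)) h)

⟦whiskerL⟧⁺ : ∀ s D {xs ys} → Whisker s ⟦ D ⟧ xs ys → ⟦ whiskerL s D ⟧ xs ys
⟦whiskerL⟧⁺ s []            w = Whisker-≡ s w
⟦whiskerL⟧⁺ s ((l , _) ∷ D) w with Whisker-⨾⁻ s w
... | ws , g , h = ws , Whisker-merge s l g , ⟦whiskerL⟧⁺ s D h

whiskerL-zero : ∀ D → whiskerL 0 D ≡ D
whiskerL-zero D = trans (map-cong (λ _ → refl) D) (map-id D)

record Local (g : Gen) (xs ys : List Label) : Set where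
  constructor local
  field
    inputs outputs rest : List Label
    xs≡ : xs ≡ inputs ++ rest
    ys≡ : ys ≡ outputs ++ rest
    length-inputs  : length inputs ≡ ins g
    length-outputs : length outputs ≡ outs g
    uniform : ∀ rest′ → ⟦ g ⟧ᵍ (inputs ++ rest′) (outputs ++ rest′)

⟦⟧ᵍ-local : ∀ g {xs ys} → ⟦ g ⟧ᵍ xs ys → Local g xs ys
⟦⟧ᵍ-local u   {xs} (d , refl) = local [] ((leaf , d) ∷ []) xs refl refl refl refl (λ _ → d , refl)
⟦⟧ᵍ-local cup {xs} (a , refl) = local [] (a ∷ swap a ∷ []) xs refl refl refl refl (λ _ → a , refl)
⟦⟧ᵍ-local f   {x ∷ xs} refl   = local (x ∷ []) [] xs refl refl refl refl (λ _ → refl)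
⟦⟧ᵍ-local cap {x ∷ _ ∷ xs} (refl , refl) =
  local (x ∷ swap x ∷ []) [] xs refl refl refl refl (λ _ → refl , refl)
⟦⟧ᵍ-local m   {x ∷ y ∷ xs} (d , ex , ey , refl) =
  local (x ∷ y ∷ []) ((node (up x) (up y) , d) ∷ []) xs refl refl refl refl (λ _ → d , ex , ey , refl)

⟦⟧ᵍ-length : ∀ g {xs ys} → ⟦ g ⟧ᵍ xs ys → length ys + ins g ≡ length xs + outs g
⟦⟧ᵍ-length g γ with ⟦⟧ᵍ-local g γ
... | local i o r refl refl li lo _ rewrite sym li | sym lo = begin
  length (o ++ r) + length i       ≡⟨ cong (_+ length i) (length-++ o) ⟩
  length o + length r + length i   ≡⟨ solve 3 (λ a b c → a :+ b :+ c := c :+ b :+ a) refl (length o) (length r) (length i) ⟩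
  length i + length r + length o   ≡⟨ cong (_+ length o) (sym (length-++ i)) ⟩
  length (i ++ r) + length o       ∎
  where open ≡-Reasoning

Whisker-⟦⟧ᵍ-length : ∀ l g {xs ys} → Whisker l ⟦ g ⟧ᵍ xs ys → length ys + ins g ≡ length xs + outs g
Whisker-⟦⟧ᵍ-length zero    g γ = ⟦⟧ᵍ-length g γ
Whisker-⟦⟧ᵍ-length (suc l) g {_ ∷ _} {_ ∷ _} (_ , γ) = cong suc (Whisker-⟦⟧ᵍ-length l g γ)

Typed-length : ∀ {n P b xs ys} → Typed n P b → ⟦ P ⟧ xs ys → length xs ≡ n → length ys ≡ b
Typed-length done refl e = e
Typed-length (next {l = l} {g = g} r refl t) (_ , γ , h) e = Typed-length t h
  (+-cancelʳ-≡ (ins g) _ _ (trans (Whisker-⟦⟧ᵍ-length l g γ)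
    (trans (cong (_+ outs g) e)
      (solve 4 (λ a b c d → a :+ b :+ c :+ d := a :+ d :+ c :+ b) refl l (ins g) r (outs g)))))

slide-up : ∀ g t {H : WireRel Label} {xs ys zs} → ⟦ g ⟧ᵍ xs ys → Whisker (outs g + t) H ys zs →
           (Whisker (t + ins g) H ⨾ ⟦ g ⟧ᵍ) xs zs
slide-up g t {H} γ w with ⟦⟧ᵍ-local g γ
... | local i o r refl refl li lo uniform
  with Whisker-++ˡ⁻ o t (subst (λ k → Whisker (k + t) H (o ++ r) _) (sym lo) w)
... | zs′ , refl , w′ =
  i ++ zs′ , subst (λ k → Whisker k H (i ++ r) (i ++ zs′)) (trans (cong (_+ t) li) (+-comm (ins g) t)) (Whisker-++ i t w′) , uniform zs′

slide-down : ∀ g t {H : WireRel Label} {xs ys zs} → Whisker (ins g + t) H xs ys → ⟦ g ⟧ᵍ ys zs →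
             (⟦ g ⟧ᵍ ⨾ Whisker (t + outs g) H) xs zs
slide-down g t {H} w γ with ⟦⟧ᵍ-local g γ
... | local i o r refl refl li lo uniform
  with Whisker-++ʳ⁻ i t (subst (λ k → Whisker (k + t) H _ (i ++ r)) (sym li) w)
... | xs′ , refl , w′ =
  o ++ xs′ , uniform xs′ , subst (λ k → Whisker k H (o ++ xs′) (o ++ r)) (trans (cong (_+ t) lo) (+-comm (outs g) t)) (Whisker-++ o t w′)

interchange₁-sound : ∀ g₁ {H : WireRel Label} l₁ l₂ {xs ys zs} → l₁ + outs g₁ ≤ l₂ →
                     Whisker l₁ ⟦ g₁ ⟧ᵍ xs ys → Whisker l₂ H ys zs →
                     (Whisker (l₂ ∸ outs g₁ + ins g₁) H ⨾ Whisker l₁ ⟦ g₁ ⟧ᵍ) xs zs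
interchange₁-sound g₁ {H} zero l₂ le γ w =
  slide-up g₁ (l₂ ∸ outs g₁) γ (subst (λ k → Whisker k H _ _) (sym (m+[n∸m]≡n le)) w)
interchange₁-sound g₁ {H} (suc l₁) (suc l₂) {x ∷ xs} {_ ∷ _} {_ ∷ _} (s≤s le) (refl , γ) (refl , w)
  with interchange₁-sound g₁ l₁ l₂ le γ w
... | ys , w′ , γ′ = x ∷ ys ,
  subst (λ k → Whisker k H (x ∷ xs) (x ∷ ys)) (sym (cong (_+ ins g₁) (+-∸-assoc 1 (m+n≤o⇒n≤o l₁ le)))) (refl , w′) ,
  (refl , γ′)

interchange₂-sound : ∀ g₂ {G : WireRel Label} l₁ l₂ {xs ys zs} → l₂ + ins g₂ ≤ l₁ →
                     Whisker l₁ G xs ys → Whisker l₂ ⟦ g₂ ⟧ᵍ ys zs →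
                     (Whisker l₂ ⟦ g₂ ⟧ᵍ ⨾ Whisker (l₁ ∸ ins g₂ + outs g₂) G) xs zs
interchange₂-sound g₂ {G} l₁ zero le w γ =
  slide-down g₂ (l₁ ∸ ins g₂) (subst (λ k → Whisker k G _ _) (sym (m+[n∸m]≡n le)) w) γ
interchange₂-sound g₂ {G} (suc l₁) (suc l₂) {x ∷ _} {_ ∷ _} {_ ∷ zs} (s≤s le) (refl , w) (refl , γ)
  with interchange₂-sound g₂ l₁ l₂ le w γ
... | ys , γ′ , w′ = x ∷ ys , (refl , γ′) ,
  subst (λ k → Whisker k G (x ∷ ys) (x ∷ zs)) (sym (cong (_+ outs g₂) (+-∸-assoc 1 (m+n≤o⇒n≤o l₂ le)))) (refl , w′)

Cell-sound : ∀ {a b A B} → Cell a b A B → ∀ {xs ys} → a ≤ length xs → ⟦ A ⟧ xs ys → ⟦ B ⟧ xs ys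
Cell-sound σ₁ {_ ∷ _} _ (_ ∷ _ , (refl , (_ , refl)) , (_ , (refl , refl) , refl)) = refl
Cell-sound σ₁⁻¹ {x ∷ xs} _ refl = x ∷ swap x ∷ x ∷ xs , (refl , (swap x , refl)) , (x ∷ xs , (refl , refl) , refl)
Cell-sound σ₂ {_ ∷ _} _ (_ , (_ , refl) , (_ ∷ _ , (refl , (refl , refl)) , refl)) = refl
Cell-sound σ₂⁻¹ {x ∷ xs} _ refl = x ∷ swap x ∷ x ∷ xs , (x , refl) , (x ∷ xs , (refl , (refl , refl)) , refl)
Cell-sound R-m {(x₁ , x₂) ∷ (y₁ , y₂) ∷ xs} _ (_ , (d , refl , refl , refl) , refl) =
  let c = (node x₁ y₁ , d) in
  c ∷ swap c ∷ (x₁ , x₂) ∷ (y₁ , y₂) ∷ xs , (c , refl) ,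
  (c ∷ (node d x₁ , y₁) ∷ (y₁ , y₂) ∷ xs , (refl , (y₁ , refl , refl , refl)) ,
  (c ∷ xs , (refl , (refl , refl)) , refl))
Cell-sound L-m {(x₁ , x₂) ∷ (y₁ , y₂) ∷ xs} _ (_ , (d , refl , refl , refl) , refl) =
  let c = (d , node x₁ y₁) in
  (x₁ , x₂) ∷ (y₁ , y₂) ∷ c ∷ swap c ∷ xs , (refl , (refl , (c , refl))) ,
  ((x₁ , x₂) ∷ (node y₁ d , x₁) ∷ swap c ∷ xs , (refl , (x₁ , refl , refl , refl)) ,
  (swap c ∷ xs , (refl , refl) , refl))
Cell-sound R-u {xs} _ (_ , (d , refl) , refl) =
  (leaf , d) ∷ xs , (d , refl) , ((leaf , d) ∷ (d , leaf) ∷ (leaf , d) ∷ xs , ((leaf , d) , refl) ,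
  ((leaf , d) ∷ xs , (refl , (refl , refl)) , refl))
Cell-sound L-u {xs} _ (_ , (d , refl) , refl) =
  (leaf , d) ∷ xs , (d , refl) , ((leaf , d) ∷ (d , leaf) ∷ (leaf , d) ∷ xs , (refl , ((d , leaf) , refl)) ,
  ((leaf , d) ∷ xs , (refl , refl) , refl))
Cell-sound R-f {x ∷ xs} _ (_ , refl , refl) =
  x ∷ swap x ∷ x ∷ xs , (x , refl) , (swap x ∷ x ∷ xs , refl , (xs , (refl , refl) , refl))
Cell-sound L-f {x ∷ xs} _ (_ , refl , refl) =
  x ∷ swap x ∷ x ∷ xs , (refl , (swap x , refl)) ,
  (x ∷ swap x ∷ xs , (refl , (refl , refl)) , (xs , (refl , refl) , refl))

Step-sound : ∀ {n X Y} → Step n X Y → ∀ {xs ys} → length xs ≡ n → ⟦ X ⟧ xs ys → ⟦ Y ⟧ xs ys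
Step-sound (cell {a = a} {A = A} {B = B} {P = P} s r c t) e h with ⟦++⟧⁻ P h
... | zs , hP , h′ with ⟦++⟧⁻ (whiskerL s A) h′
... | _ , hA , hQ = ⟦++⟧⁺ P (zs , hP , ⟦++⟧⁺ (whiskerL s B) (_ , ⟦whiskerL⟧⁺ s B wB , hQ))
  where
    room : s + a ≤ length zs
    room = ≤-trans (m≤m+n (s + a) r) (≤-reflexive (sym (Typed-length t hP e)))
    wB = Whisker-map s a (Cell-sound c) room (⟦whiskerL⟧⁻ s A (m+n≤o⇒m≤o s room) hA)
Step-sound (interchange₁ {P = P} {l₁ = l₁} {g₁ = g₁} {l₂ = l₂} le) _ h with ⟦++⟧⁻ P h
... | zs , hP , (_ , γ₁ , (vs , γ₂ , hQ)) with interchange₁-sound g₁ l₁ l₂ le γ₁ γ₂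
... | ws , γ₂′ , γ₁′ = ⟦++⟧⁺ P (zs , hP , (ws , γ₂′ , (vs , γ₁′ , hQ)))
Step-sound (interchange₂ {P = P} {l₁ = l₁} {l₂ = l₂} {g₂ = g₂} le) _ h with ⟦++⟧⁻ P h
... | zs , hP , (_ , γ₁ , (vs , γ₂ , hQ)) with interchange₂-sound g₂ l₁ l₂ le γ₁ γ₂
... | ws , γ₂′ , γ₁′ = ⟦++⟧⁺ P (zs , hP , (ws , γ₂′ , (vs , γ₁′ , hQ)))

Rotational-sound : ∀ {n X Y} → Rotational n X Y → ∀ {xs ys} → length xs ≡ n → ⟦ X ⟧ xs ys → ⟦ Y ⟧ xs ys
Rotational-sound ε         _ h = h
Rotational-sound (s ◅ ss) e h = Rotational-sound ss e (Step-sound s e h)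

tree : ∀ {n X} → LPForm n X → Tree
tree lp-u       = leaf
tree (lp-m U V) = node (tree U) (tree V)

LPForm-nullary : ∀ {n X} → LPForm n X → n ≡ 0
LPForm-nullary lp-u = refl
LPForm-nullary (lp-m U V) rewrite LPForm-nullary U | LPForm-nullary V = refl

whiskerL-nullary : ∀ {k X} → LPForm k X → ∀ D → whiskerL k D ≡ D
whiskerL-nullary U D = subst (λ k → whiskerL k D ≡ D) (sym (LPForm-nullary U)) (whiskerL-zero D)

⟦LPForm⟧-tree : ∀ {n X} (U : LPForm n X) xs d → ⟦ X ⟧ xs ((tree U , d) ∷ xs)
⟦LPForm⟧-tree lp-u xs d = _ , (d , refl) , refl
⟦LPForm⟧-tree (lp-m {U = X} {V = Y} U V) xs d
  rewrite whiskerL-nullary U Y =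
  ⟦++⟧⁺ Y (_ , ⟦LPForm⟧-tree V xs (node d (tree U)) ,
    ⟦++⟧⁺ X (_ , ⟦LPForm⟧-tree U _ (node (tree V) d) , (_ , (d , refl , refl , refl) , refl)))

⟦LPForm⟧⇒tree : ∀ {n X} (U : LPForm n X) {xs ys} → ⟦ X ⟧ xs ys → ∃ λ d → ys ≡ (tree U , d) ∷ xs
⟦LPForm⟧⇒tree lp-u (_ , (d , refl) , refl) = d , refl
⟦LPForm⟧⇒tree (lp-m {U = X} {V = Y} U V) h rewrite whiskerL-nullary U Y
  with ⟦++⟧⁻ Y h
... | _ , hY , h′ with ⟦LPForm⟧⇒tree V hY
... | _ , refl with ⟦++⟧⁻ X h′
... | _ , hX , hm with ⟦LPForm⟧⇒tree U hX
... | _ , refl with hm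
... | _ , (d , _ , _ , refl) , refl = d , refl

tree-injective : ∀ {n n′ X Y} (U : LPForm n X) (V : LPForm n′ Y) → tree U ≡ tree V → X ≡ Y
tree-injective lp-u       lp-u         _ = refl
tree-injective (lp-m {U = X} {V = Y} U V) (lp-m U′ V′) e with node-injective e
... | eU , eV with tree-injective U U′ eU | tree-injective V V′ eV
... | refl | refl = cong (λ k → whiskerL k Y ++ X ++ (0 , m) ∷ []) (trans (LPForm-nullary U) (sym (LPForm-nullary U′)))

mainTheorem14 : ∀ {n : ℕ} {X Y : Diagram} →
    LPForm n X → LPForm n Y → Rotational n X Y → X ≡ Y
mainTheorem14 U V rot
  with ⟦LPForm⟧⇒tree V (Rotational-sound rot (sym (LPForm-nullary U)) (⟦LPForm⟧-tree U [] leaf))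
... | _ , e = tree-injective U V (cong proj₁ (∷-injectiveˡ e))
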